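{- There is no online bin covering algorithm with advice complexity $o(\log\log n)$ whose competitive ratio is strictly better (larger) than $1/2$. That is, for every online bin covering algorithm $A$ with advice complexity $s(n)\in o(\log\log n)$ and every constant $\mu>0$, $A$ is not $(1/2+\mu)$-competitive.
   Context: Bin covering: items with sizes in $(0,1]$ arrive online and each must be irrevocably placed into a bin; a bin is covered if the total size of its items is at least $1$; the goal is to maximize the number of covered bins. In the advice-on-tape model, an oracle with unlimited power writes an advice string on a tape beforehand; the decision for the $i$-th item may depend on the advice and the sizes of the first $i$ items. $A(\sigma)$ is the number of bins covered by $A$ on $\sigma$ and $\mathrm{OPT}(\sigma)$ the maximum possible number. $A$ is $c$-competitive with advice complexity $s(n)$ if there is a constant $b$ such that for all $n$ and all input sequences $\sigma$ of length at most $n$ there is an advice string $\Phi$ such that $A(\sigma)\ge c\cdot \mathrm{OPT}(\sigma)-b$ and $A$ reads at most $s(n)$ bits of $\Phi$. The competitive ratio is the supremum of all $c$ for which $A$ is $c$-competitive.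
   Formalization: The constant μ ranges over the positive rationals, and the item sizes and the additive constant b are taken in ℚ. -}

module Defs where

open import Data.Nat as ℕ using (ℕ; zero; suc; _⊔_; _^_)
open import Data.Integer using (+_)
open import Data.Rational using (ℚ; 0ℚ; 1ℚ; _/_; _+_; _*_; _-_; _≤_; _<_)
open import Data.Rational.Properties using (_≤?_)
open import Data.List using (List; []; _∷_; [_]; map; foldr; length; zip; filter; upTo; concatMap)
open import Data.Bool using (Bool)
open import Data.Product using (Σ; ∃; _×_)
open import Data.List.Relation.Unary.All using (All)
open import Relation.Binary.PropositionalEquality using (_≡_)
open import Relation.Nullary using (¬_)

ValidItem : ℚ → Set
ValidItem x = (0ℚ < x) × (x ≤ 1ℚ)

Advice : Set
Advice = ℕ → Bool

-- An online algorithm with advice: given the advice tape and the sizes of the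
-- first i items (σ_1 … σ_i, the last one being the current item), it returns the
-- index of the bin (bins are numbered by ℕ) into which item i is placed.
-- (The value on the empty prefix is never used.)
Algorithm : Set
Algorithm = Advice → List ℚ → ℕ

prefixes : List ℚ → List (List ℚ)
prefixes []       = []
prefixes (x ∷ xs) = [ x ] ∷ map (x ∷_) (prefixes xs)

run : Algorithm → Advice → List ℚ → List ℕ
run A Φ σ = map (A Φ) (prefixes σ)

toℚ : ℕ → ℚ
toℚ n = + n / 1

load : List ℚ → List ℕ → ℕ → ℚ
load σ f j = foldr (λ p acc → step p acc) 0ℚ (zip σ f)
  where
  step : _ → ℚ → ℚ
  step (x Data.Product., k) acc with k ℕ.≟ j
  ... | Relation.Nullary.yes _ = x + acc
  ... | Relation.Nullary.no  _ = acc

maxℕ : List ℕ → ℕ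
maxℕ = foldr _⊔_ 0

covered : List ℚ → List ℕ → ℕ
covered σ f = length (filter (λ j → 1ℚ ≤? load σ f j) (upTo (suc (maxℕ f))))

assignments : ℕ → ℕ → List (List ℕ)
assignments zero    m = [] ∷ []
assignments (suc k) m = concatMap (λ j → map (j ∷_) (assignments k m)) (upTo m)

-- OPT(σ): the maximum number of covered bins over all (offline) assignments.
-- Bins 0 … |σ|-1 suffice since at most |σ| bins are nonempty.
OPT : List ℚ → ℕ
OPT σ = maxℕ (map (covered σ) (assignments (length σ) (length σ)))

Acov : Algorithm → Advice → List ℚ → ℕ
Acov A Φ σ = covered σ (run A Φ σ)

AgreeUpTo : ℕ → Advice → Advice → Set
AgreeUpTo k Φ Ψ = ∀ i → i ℕ.< k → Φ i ≡ Ψ i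

-- A is c-competitive with advice complexity s: there is a constant b such that
-- for all n and all valid σ with |σ| ≤ n there is an advice string Φ with
-- A(σ) ≥ c·OPT(σ) − b, and A reads at most s(n) bits of Φ (its behaviour on σ is
-- determined by the first s(n) bits of Φ).
Competitive : Algorithm → (ℕ → ℕ) → ℚ → Set
Competitive A s c =
  Σ ℚ λ b → ∀ (n : ℕ) (σ : List ℚ) → length σ ℕ.≤ n → All ValidItem σ →
    Σ Advice λ Φ →
      (c * toℚ (OPT σ) - b ≤ toℚ (Acov A Φ σ)) ×
      (∀ Ψ → AgreeUpTo (s n) Φ Ψ → run A Ψ σ ≡ run A Φ σ)

-- s ∈ o(log log n): for every k ≥ 1, eventually s(n) ≤ (1/k)·log₂ log₂ n,
-- i.e. 2^(2^(k·s(n))) ≤ n.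
LittleOLogLog : (ℕ → ℕ) → Set
LittleOLogLog s = ∀ (k : ℕ) → 1 ℕ.≤ k → ∃ λ N → ∀ n → N ℕ.≤ n → 2 ^ (2 ^ (k ℕ.* s n)) ℕ.≤ n

-- An algorithm reading s advice bits behaves like one of m = 2^s deterministic algorithms.
-- Take P with P·μ ≥ 1, Q ≥ b, K = P(Q+1) and r = 4Pm, and first send N = 2^(r+1)·K tiny items
-- of size ε = 2^-(r+1). Every placement of N items satisfies
-- ∑_{i<r} 2^i·#(bins with at least 2^(i+1) items) ≤ N, so summing over the m advice strings,
-- some level i < r has total at most mN/r: with t = 2^(i+1) and V = N/2t, every advice string
-- puts t tiny items into at most D bins, where P·D ≤ V. Then send 2V large items of size 1 − tε.
-- An optimal covering fills 2V bins with t tiny items and one large item each, whereas every bin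
-- the algorithm covers holds t tiny items or two large ones, so it covers at most D + V bins,
-- which is less than (½+μ)·2V − b. The input has length 2^O(m), at most n once s(n) ∈ o(log log n).

module Submission where

open import Defs
open import Algebra.Bundles using (CommutativeRing)
open import Data.Bool using (Bool; true; false; if_then_else_)
open import Data.Empty using (⊥-elim)
import Data.Integer as ℤ
import Data.Integer.Properties as ℤP
open import Data.List
  using (List; []; _∷_; [_]; _++_; length; map; concat; replicate; downFrom; filter; applyUpTo)
open import Data.List.Properties
  using (++-identityʳ; length-replicate; length-downFrom; length-++; length-map; map-++; map-∘; map-id)
open import Data.List.Membership.Propositional using (_∈_)
open import Data.List.Membership.Propositional.Properties
  using (∈-map⁺; ∈-concat⁺′; ∈-upTo⁺; ∈-++⁺ˡ; ∈-++⁺ʳ)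
open import Data.List.Relation.Unary.All using (All; []; _∷_)
open import Data.List.Relation.Unary.All.Properties using (++⁺; replicate⁺; concat⁺; applyDownFrom⁺₁)
open import Data.List.Relation.Unary.Any using (here; there)
open import Data.Nat as ℕ
  using (ℕ; zero; suc; _⊔_; _+_; _*_; _∸_; _^_; _≤_; _<_; z≤n; s≤s; z<s; s<s; _≟_; _≤?_)
open import Data.Nat.ListAction using (sum)
open import Data.Nat.Properties
import Data.Nat.Coprimality as Coprime
open import Data.Nat.Solver using () renaming (module +-*-Solver to ℕ-Solver)
open import Data.Product using (∃; _×_; _,_; proj₁; proj₂)
open import Data.Rational as ℚ using (ℚ; mkℚ; 0ℚ; 1ℚ; ½)
import Data.Rational.Properties as ℚP
open import Data.Rational.Solver using () renaming (module +-*-Solver to ℚ-Solver)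
import Data.Rational.Unnormalised as ℚᵘ
import Data.Rational.Unnormalised.Properties as ℚᵘP
open import Data.Sum using (inj₁; inj₂)
open import Function using (_∘_)
open import Relation.Nullary using (Dec; yes; no; does; ¬_)
open import Relation.Unary using (Decidable)
open import Relation.Binary.PropositionalEquality hiding ([_])

open import Algebra.Properties.CommutativeSemigroup +-commutativeSemigroup
  using () renaming (interchange to +-interchange)
open import Algebra.Properties.Semiring.Mult (CommutativeRing.semiring ℚP.+-*-commutativeRing)
  using ()
  renaming (_×_ to _·_; ×-homo-+ to ·-homo-+; ×-homo-1 to ·-homo-1; ×-assocˡ to ·-assocˡ; ×-comm-* to ·-comm-*)

-- Rational arithmetic

toℚ≡mkℚ : ∀ n → toℚ n ≡ mkℚ (ℤ.+ n) 0 (Coprime.sym (Coprime.1-coprimeTo n))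
toℚ≡mkℚ n = ℚP.normalize-coprime _

toℚ-suc : ∀ n → toℚ (suc n) ≡ 1ℚ ℚ.+ toℚ n
toℚ-suc n = trans (ℚP./-cong {q₁ = 1} {q₂ = 1} numerator refl) (cong (1ℚ ℚ.+_) (sym (toℚ≡mkℚ n)))
  where
  numerator : ℤ.+ suc n ≡ ℤ.1ℤ ℤ.* ℤ.1ℤ ℤ.+ ℤ.+ n ℤ.* ℤ.1ℤ
  numerator = cong (ℤ._+_ ℤ.1ℤ) (sym (ℤP.*-identityʳ (ℤ.+ n)))

<⇒≱ℚ : ∀ {p q} → p ℚ.< q → ¬ (q ℚ.≤ p)
<⇒≱ℚ p<q q≤p = ℚP.<-irrefl refl (ℚP.<-≤-trans p<q q≤p)

toℚ≡·1 : ∀ n → toℚ n ≡ n · 1ℚ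
toℚ≡·1 zero    = refl
toℚ≡·1 (suc n) = trans (toℚ-suc n) (cong (1ℚ ℚ.+_) (toℚ≡·1 n))

·≡*toℚ : ∀ n x → n · x ≡ x ℚ.* toℚ n
·≡*toℚ n x = begin
  n · x            ≡⟨ cong (n ·_) (ℚP.*-identityʳ x) ⟨
  n · (x ℚ.* 1ℚ)   ≡⟨ ·-comm-* n x 1ℚ ⟨
  x ℚ.* (n · 1ℚ)   ≡⟨ cong (x ℚ.*_) (toℚ≡·1 n) ⟨
  x ℚ.* toℚ n      ∎
  where open ≡-Reasoning

·-nonNeg : ∀ n {x} → 0ℚ ℚ.≤ x → 0ℚ ℚ.≤ n · x
·-nonNeg zero    0≤x = ℚP.≤-refl
·-nonNeg (suc n) 0≤x = ℚP.+-mono-≤ 0≤x (·-nonNeg n 0≤x)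

·-monoʳ-≤ : ∀ n {x y} → x ℚ.≤ y → n · x ℚ.≤ n · y
·-monoʳ-≤ zero    x≤y = ℚP.≤-refl
·-monoʳ-≤ (suc n) x≤y = ℚP.+-mono-≤ x≤y (·-monoʳ-≤ n x≤y)

·-monoˡ-≤ : ∀ {m n} x → 0ℚ ℚ.≤ x → m ≤ n → m · x ℚ.≤ n · x
·-monoˡ-≤ {m} {n} x 0≤x m≤n = begin
  m · x                   ≡⟨ ℚP.+-identityʳ (m · x) ⟨
  m · x ℚ.+ 0ℚ            ≤⟨ ℚP.+-monoʳ-≤ (m · x) (·-nonNeg (n ∸ m) 0≤x) ⟩
  m · x ℚ.+ (n ∸ m) · x   ≡⟨ ·-homo-+ x m (n ∸ m) ⟨
  (m + (n ∸ m)) · x       ≡⟨ cong (_· x) (m+[n∸m]≡n m≤n) ⟩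
  n · x                   ∎
  where open ℚP.≤-Reasoning

toℚ-+ : ∀ m n → toℚ (m + n) ≡ toℚ m ℚ.+ toℚ n
toℚ-+ m n = begin
  toℚ (m + n)         ≡⟨ toℚ≡·1 (m + n) ⟩
  (m + n) · 1ℚ        ≡⟨ ·-homo-+ 1ℚ m n ⟩
  m · 1ℚ ℚ.+ n · 1ℚ   ≡⟨ cong₂ ℚ._+_ (toℚ≡·1 m) (toℚ≡·1 n) ⟨
  toℚ m ℚ.+ toℚ n     ∎
  where open ≡-Reasoning

toℚ-mono-≤ : ∀ {m n} → m ≤ n → toℚ m ℚ.≤ toℚ n
toℚ-mono-≤ {m} {n} m≤n =
  subst₂ ℚ._≤_ (sym (toℚ≡·1 m)) (sym (toℚ≡·1 n)) (·-monoˡ-≤ 1ℚ (ℚP.nonNegative⁻¹ 1ℚ) m≤n)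

toℚ-≤-μ* : ∀ {μ P M X} → 0ℚ ℚ.≤ μ → 1ℚ ℚ.≤ P · μ → P * M ≤ X → toℚ M ℚ.≤ μ ℚ.* toℚ X
toℚ-≤-μ* {μ} {P} {M} {X} 0≤μ 1≤P·μ P*M≤X = begin
  toℚ M              ≡⟨ toℚ≡·1 M ⟩
  M · 1ℚ             ≤⟨ ·-monoʳ-≤ M 1≤P·μ ⟩
  M · P · μ          ≡⟨ ·-assocˡ μ M P ⟩
  (M * P) · μ        ≡⟨ ·≡*toℚ (M * P) μ ⟩
  μ ℚ.* toℚ (M * P)  ≤⟨ ℚP.*-monoˡ-≤-nonNeg μ {{ℚ.nonNegative 0≤μ}}
                          (toℚ-mono-≤ (subst (_≤ X) (*-comm P M) P*M≤X)) ⟩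
  μ ℚ.* toℚ X        ∎
  where open ℚP.≤-Reasoning

toℚ-unbounded : ∀ b → ∃ λ Q → b ℚ.≤ toℚ Q
toℚ-unbounded (mkℚ (ℤ.+ n) d c) = n , subst (mkℚ (ℤ.+ n) d c ℚ.≤_) (sym (toℚ≡mkℚ n))
  (ℚ.*≤* (subst₂ ℤ._≤_ (sym (ℤP.*-identityʳ (ℤ.+ n))) (ℤP.pos-* n (suc d)) (ℤ.+≤+ (m≤m*n n (suc d)))))
toℚ-unbounded (mkℚ ℤ.-[1+ n ] d c) = 0 , subst (mkℚ ℤ.-[1+ n ] d c ℚ.≤_) (sym (toℚ≡mkℚ 0))
  (ℚ.*≤* (subst (ℤ._≤ (ℤ.+ 0) ℤ.* (ℤ.+ suc d)) (sym (ℤP.*-identityʳ ℤ.-[1+ n ])) ℤ.-≤+))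

·-archimedean : ∀ μ → 0ℚ ℚ.< μ → ∃ λ P → 1ℚ ℚ.≤ suc P · μ
·-archimedean (mkℚ (ℤ.+ zero) d c) (ℚ.*<* 0<0) = ⊥-elim (ℤP.<-irrefl refl 0<0)
·-archimedean (mkℚ ℤ.-[1+ n ] d c) (ℚ.*<* ())
·-archimedean μ@(mkℚ (ℤ.+ suc k) d c) _ = d , (begin
  1ℚ                  ≤⟨ ℚP.toℚᵘ-cancel-≤ (ℚᵘP.≤-respʳ-≃ (ℚᵘP.≃-sym (ℚP.toℚᵘ-homo-* μ 1+d))
                                                           (ℚᵘ.*≤* 1*[1+d]≤[1+k]*[1+d])) ⟩
  μ ℚ.* 1+d           ≡⟨ cong (μ ℚ.*_) (toℚ≡mkℚ (suc d)) ⟨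
  μ ℚ.* toℚ (suc d)   ≡⟨ ·≡*toℚ (suc d) μ ⟨
  suc d · μ           ∎)
  where
  open ℚP.≤-Reasoning
  1+d : ℚ
  1+d = mkℚ (ℤ.+ suc d) 0 (Coprime.sym (Coprime.1-coprimeTo (suc d)))
  1*[1+d]≤[1+k]*[1+d] : ℤ.1ℤ ℤ.* ℤ.+ (suc d * 1) ℤ.≤ (ℤ.+ suc k ℤ.* ℤ.+ suc d) ℤ.* ℤ.1ℤ
  1*[1+d]≤[1+k]*[1+d] = subst₂ ℤ._≤_
    (sym (ℤP.*-identityˡ (ℤ.+ (suc d * 1))))
    (trans (ℤP.pos-* (suc k) (suc d)) (sym (ℤP.*-identityʳ _)))
    (ℤ.+≤+ (subst (_≤ suc k * suc d) (sym (*-identityʳ (suc d))) (m≤n*m (suc d) (suc k))))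

½^_ : ℕ → ℚ
½^ zero  = 1ℚ
½^ suc k = ½ ℚ.* ½^ k

½^-pos : ∀ k → 0ℚ ℚ.< ½^ k
½^-pos zero    = ℚP.positive⁻¹ 1ℚ
½^-pos (suc k) = subst (ℚ._< ½ ℚ.* ½^ k) (ℚP.*-zeroʳ ½) (ℚP.*-monoʳ-<-pos ½ (½^-pos k))

½<1 : ½ ℚ.< 1ℚ
½<1 = ℚ.*<* (ℤ.+<+ (s≤s (s≤s z≤n)))

2^k·½^[1+k]≡½ : ∀ k → (2 ^ k) · ½^ suc k ≡ ½
2^k·½^[1+k]≡½ zero    = refl
2^k·½^[1+k]≡½ (suc k) = begin
  (2 * 2 ^ k) · (½ ℚ.* ½^ suc k)   ≡⟨ ·-assocˡ (½ ℚ.* ½^ suc k) 2 (2 ^ k) ⟨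
  2 · (2 ^ k) · (½ ℚ.* ½^ suc k)   ≡⟨ cong (2 ·_) (·-comm-* (2 ^ k) ½ (½^ suc k)) ⟨
  2 · (½ ℚ.* (2 ^ k) · ½^ suc k)   ≡⟨ cong (λ x → 2 · (½ ℚ.* x)) (2^k·½^[1+k]≡½ k) ⟩
  2 · (½ ℚ.* ½)                    ≡⟨⟩
  ½                                ∎
  where open ≡-Reasoning

-- Finite sums

-- Going through `does` makes 𝟙 (suc k ≟ suc j) and 𝟙 (k ≟ j) definitionally equal.
𝟙 : ∀ {a} {A : Set a} → Dec A → ℕ
𝟙 d = if does d then 1 else 0

𝟙-yes : ∀ {a} {A : Set a} (d : Dec A) → A → 𝟙 d ≡ 1
𝟙-yes (yes _) _ = refl
𝟙-yes (no ¬a) a = ⊥-elim (¬a a)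

𝟙-no : ∀ {a} {A : Set a} (d : Dec A) → ¬ A → 𝟙 d ≡ 0
𝟙-no (yes a) ¬a = ⊥-elim (¬a a)
𝟙-no (no _)  _  = refl

∑< : ℕ → (ℕ → ℕ) → ℕ
∑< zero    f = 0
∑< (suc M) f = f 0 + ∑< M (f ∘ suc)

syntax ∑< M (λ j → e) = ∑[ j < M ] e

∑-cong : ∀ M {f g : ℕ → ℕ} → (∀ j → f j ≡ g j) → ∑[ j < M ] f j ≡ ∑[ j < M ] g j
∑-cong zero    f≡g = refl
∑-cong (suc M) f≡g = cong₂ _+_ (f≡g 0) (∑-cong M (f≡g ∘ suc))

∑-mono-≤ : ∀ M {f g : ℕ → ℕ} → (∀ j → j < M → f j ≤ g j) → ∑[ j < M ] f j ≤ ∑[ j < M ] g j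
∑-mono-≤ zero    f≤g = z≤n
∑-mono-≤ (suc M) f≤g = +-mono-≤ (f≤g 0 z<s) (∑-mono-≤ M (λ j j<M → f≤g (suc j) (s<s j<M)))

∑-const : ∀ M c → ∑[ j < M ] c ≡ M * c
∑-const zero    c = refl
∑-const (suc M) c = cong (c +_) (∑-const M c)

∑-zero : ∀ M → ∑[ j < M ] 0 ≡ 0
∑-zero M = trans (∑-const M 0) (*-zeroʳ M)

∑-distrib-+ : ∀ M (f g : ℕ → ℕ) → ∑[ j < M ] (f j + g j) ≡ ∑[ j < M ] f j + ∑[ j < M ] g j
∑-distrib-+ zero    f g = refl
∑-distrib-+ (suc M) f g =
  trans (cong (f 0 + g 0 +_) (∑-distrib-+ M (f ∘ suc) (g ∘ suc))) (+-interchange (f 0) (g 0) _ _)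

∑-distribˡ-* : ∀ M a (f : ℕ → ℕ) → ∑[ j < M ] (a * f j) ≡ a * ∑[ j < M ] f j
∑-distribˡ-* zero    a f = sym (*-zeroʳ a)
∑-distribˡ-* (suc M) a f =
  trans (cong (a * f 0 +_) (∑-distribˡ-* M a (f ∘ suc))) (sym (*-distribˡ-+ a (f 0) _))

∑-comm : ∀ r M (f : ℕ → ℕ → ℕ) → ∑[ i < r ] ∑[ j < M ] f i j ≡ ∑[ j < M ] ∑[ i < r ] f i j
∑-comm zero    M f = sym (∑-zero M)
∑-comm (suc r) M f = trans (cong (∑< M (f 0) +_) (∑-comm r M (f ∘ suc)))
                           (sym (∑-distrib-+ M (f 0) (λ j → ∑[ i < r ] f (suc i) j)))

∑-snoc : ∀ M (f : ℕ → ℕ) → ∑[ j < suc M ] f j ≡ ∑[ j < M ] f j + f M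
∑-snoc zero    f = +-identityʳ (f 0)
∑-snoc (suc M) f = trans (cong (f 0 +_) (∑-snoc M (f ∘ suc))) (sym (+-assoc (f 0) _ _))

∑-mono-range : ∀ {M M'} (f : ℕ → ℕ) → M ≤ M' → ∑[ j < M ] f j ≤ ∑[ j < M' ] f j
∑-mono-range {zero}           f _            = z≤n
∑-mono-range {suc M} {suc M'} f (s≤s M≤M') = +-monoʳ-≤ (f 0) (∑-mono-range (f ∘ suc) M≤M')

∑-vanishing-from : ∀ M {M'} (f : ℕ → ℕ) → (∀ j → M' ≤ j → f j ≡ 0) →
                   ∑[ j < M ] f j ≤ ∑[ j < M' ] f j
∑-vanishing-from zero    {M'}     f f≡0 = z≤n
∑-vanishing-from (suc M) {zero}   f f≡0 =
  ≤-reflexive (trans (∑-cong (suc M) (λ j → f≡0 j z≤n)) (∑-zero (suc M)))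
∑-vanishing-from (suc M) {suc M'} f f≡0 =
  +-monoʳ-≤ (f 0) (∑-vanishing-from M (f ∘ suc) (λ j M'≤j → f≡0 (suc j) (s≤s M'≤j)))

∈⇒≤sum-map : ∀ {X : Set} (F : X → ℕ) {x xs} → x ∈ xs → F x ≤ sum (map F xs)
∈⇒≤sum-map F {xs = y ∷ ys} (here refl)  = m≤m+n (F y) _
∈⇒≤sum-map F {xs = y ∷ ys} (there x∈ys) = ≤-trans (∈⇒≤sum-map F x∈ys) (m≤n+m _ (F y))

sum-map-≤ : ∀ {X : Set} (F : X → ℕ) xs {N} → (∀ x → F x ≤ N) → sum (map F xs) ≤ length xs * N
sum-map-≤ F []       F≤N = z≤n
sum-map-≤ F (x ∷ xs) F≤N = +-mono-≤ (F≤N x) (sum-map-≤ F xs F≤N)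

∑-sum-map-comm : ∀ {X : Set} r xs (f : X → ℕ → ℕ) →
                 ∑[ i < r ] sum (map (λ x → f x i) xs) ≡ sum (map (λ x → ∑[ i < r ] f x i) xs)
∑-sum-map-comm r []       f = ∑-zero r
∑-sum-map-comm r (x ∷ xs) f = trans (∑-distrib-+ r (f x) (λ i → sum (map (λ y → f y i) xs)))
                                    (cong (∑< r (f x) +_) (∑-sum-map-comm r xs f))

argmin : ∀ (f : ℕ → ℕ) r → 0 < r → ∃ λ i → i < r × (∀ j → j < r → f i ≤ f j)
argmin f (suc zero)    _ = 0 , z<s , λ { zero _ → ≤-refl ; (suc j) (s≤s ()) }
argmin f (suc (suc r)) _ with argmin (f ∘ suc) (suc r) z<s
... | i , i<r , min with f 0 ≤? f (suc i)
...   | yes f0≤ = 0 , z<s , λ { zero _ → ≤-refl ; (suc j) (s≤s j<r) → ≤-trans f0≤ (min j j<r) }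
...   | no  f0≰ = suc i , s<s i<r , λ { zero _ → <⇒≤ (≰⇒> f0≰) ; (suc j) (s≤s j<r) → min j j<r }

pigeonhole : ∀ (f : ℕ → ℕ) r → 0 < r → ∃ λ i → i < r × r * f i ≤ ∑[ j < r ] f j
pigeonhole f r 0<r with argmin f r 0<r
... | i , i<r , min = i , i<r , subst (_≤ ∑< r f) (∑-const r (f i)) (∑-mono-≤ r min)

a*𝟙[a≤c]≤c : ∀ a c → a * 𝟙 (a ≤? c) ≤ c
a*𝟙[a≤c]≤c a c = bound (a ≤? c)
  where
  bound : (d : Dec (a ≤ c)) → a * 𝟙 d ≤ c
  bound (yes a≤c) = subst (_≤ c) (sym (*-identityʳ a)) a≤c
  bound (no  _)   = subst (_≤ c) (sym (*-zeroʳ a)) z≤n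

n<2^n : ∀ n → n < 2 ^ n
n<2^n zero    = z<s
n<2^n (suc n) = ≤-<-trans (n<2^n n) (m<m+n (2 ^ n) (≤-trans (m^n>0 2 n) (m≤m+n (2 ^ n) 0)))

-- The bound by 2 ^ r is what carries the induction: level r contributes 2 ^ r only if 2 ^ (1+r) ≤ c.
dyadic-layers : ∀ c r → let S = ∑[ i < r ] (2 ^ i * 𝟙 (2 ^ suc i ≤? c)) in S < 2 ^ r × S ≤ c
dyadic-layers c zero    = z<s , z≤n
dyadic-layers c (suc r) rewrite ∑-snoc r (λ i → 2 ^ i * 𝟙 (2 ^ suc i ≤? c)) = next (2 ^ suc r ≤? c)
  where
  S : ℕ
  S = ∑[ i < r ] (2 ^ i * 𝟙 (2 ^ suc i ≤? c))
  next : (d : Dec (2 ^ suc r ≤ c)) → S + 2 ^ r * 𝟙 d < 2 ^ suc r × S + 2 ^ r * 𝟙 d ≤ c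
  next (yes 2^[1+r]≤c) = S+2^r<2^[1+r] , ≤-trans (<⇒≤ S+2^r<2^[1+r]) 2^[1+r]≤c
    where
    S+2^r<2^[1+r] : S + 2 ^ r * 1 < 2 ^ suc r
    S+2^r<2^[1+r] rewrite *-identityʳ (2 ^ r) | +-identityʳ (2 ^ r) =
      +-monoˡ-< (2 ^ r) (proj₁ (dyadic-layers c r))
  next (no _) rewrite *-zeroʳ (2 ^ r) | +-identityʳ S =
    <-≤-trans (proj₁ (dyadic-layers c r)) (^-monoʳ-≤ 2 (n≤1+n r)) , proj₂ (dyadic-layers c r)

-- Bin occupancy

count : ℕ → List ℕ → ℕ
count j []      = 0
count j (k ∷ g) = 𝟙 (k ≟ j) + count j g

count-++ : ∀ j g f → count j (g ++ f) ≡ count j g + count j f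
count-++ j []      f = refl
count-++ j (k ∷ g) f = trans (cong (𝟙 (k ≟ j) +_) (count-++ j g f)) (sym (+-assoc (𝟙 (k ≟ j)) _ _))

count-concat-replicate : ∀ j t L → count j (concat (replicate t L)) ≡ t * count j L
count-concat-replicate j zero    L = refl
count-concat-replicate j (suc t) L =
  trans (count-++ j L _) (cong (count j L +_) (count-concat-replicate j t L))

count-downFrom-≥ : ∀ {j} B → B ≤ j → count j (downFrom B) ≡ 0
count-downFrom-≥ zero    _   = refl
count-downFrom-≥ (suc B) B<j =
  cong₂ _+_ (𝟙-no (B ≟ _) (λ B≡j → <-irrefl B≡j B<j)) (count-downFrom-≥ B (<⇒≤ B<j))

count-downFrom-< : ∀ {j} B → j < B → count j (downFrom B) ≡ 1
count-downFrom-< {j} (suc B) (s≤s j≤B) with m≤n⇒m<n∨m≡n j≤B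
... | inj₁ j<B  = cong₂ _+_ (𝟙-no (B ≟ j) (λ B≡j → <-irrefl (sym B≡j) j<B)) (count-downFrom-< B j<B)
... | inj₂ refl = cong₂ _+_ (𝟙-yes (B ≟ j) refl) (count-downFrom-≥ B ≤-refl)

count-beyond-max : ∀ {j} g → maxℕ g < j → count j g ≡ 0
count-beyond-max []      _     = refl
count-beyond-max (k ∷ g) max<j =
  cong₂ _+_ (𝟙-no (k ≟ _) (λ k≡j → <-irrefl k≡j (≤-<-trans (m≤m⊔n k (maxℕ g)) max<j)))
            (count-beyond-max g (≤-<-trans (m≤n⊔m k (maxℕ g)) max<j))

∑-𝟙[k≟j]≤1 : ∀ k M → ∑[ j < M ] 𝟙 (k ≟ j) ≤ 1
∑-𝟙[k≟j]≤1 k       zero    = z≤n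
∑-𝟙[k≟j]≤1 zero    (suc M) = s≤s (≤-reflexive (∑-zero M))
∑-𝟙[k≟j]≤1 (suc k) (suc M) = ∑-𝟙[k≟j]≤1 k M

∑-count≤length : ∀ M g → ∑[ j < M ] count j g ≤ length g
∑-count≤length M []      = ≤-reflexive (∑-zero M)
∑-count≤length M (k ∷ g) = begin
  ∑[ j < M ] (𝟙 (k ≟ j) + count j g)             ≡⟨ ∑-distrib-+ M (λ j → 𝟙 (k ≟ j)) (λ j → count j g) ⟩
  ∑[ j < M ] 𝟙 (k ≟ j) + ∑[ j < M ] count j g   ≤⟨ +-mono-≤ (∑-𝟙[k≟j]≤1 k M) (∑-count≤length M g) ⟩
  suc (length g)                                ∎
  where open ≤-Reasoning

length-concat-replicate : ∀ t (L : List ℕ) → length (concat (replicate t L)) ≡ t * length L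
length-concat-replicate zero    L = refl
length-concat-replicate (suc t) L =
  trans (length-++ L) (cong (length L +_) (length-concat-replicate t L))

bins≥ : ℕ → List ℕ → ℕ
bins≥ t g = ∑[ j < suc (maxℕ g) ] 𝟙 (t ≤? count j g)

∑-𝟙≤bins≥ : ∀ {t} g M → 1 ≤ t → ∑[ j < M ] 𝟙 (t ≤? count j g) ≤ bins≥ t g
∑-𝟙≤bins≥ {t} g M 1≤t = ∑-vanishing-from M (λ j → 𝟙 (t ≤? count j g)) λ j max<j →
  𝟙-no (t ≤? count j g) (λ t≤count → <⇒≱ 1≤t (subst (t ≤_) (count-beyond-max g max<j) t≤count))

*-bins≥≤length : ∀ a g → a * bins≥ a g ≤ length g
*-bins≥≤length a g = begin
  a * bins≥ a g                         ≡⟨ ∑-distribˡ-* M a (λ j → 𝟙 (a ≤? count j g)) ⟨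
  ∑[ j < M ] (a * 𝟙 (a ≤? count j g))   ≤⟨ ∑-mono-≤ M (λ j _ → a*𝟙[a≤c]≤c a (count j g)) ⟩
  ∑[ j < M ] count j g                  ≤⟨ ∑-count≤length M g ⟩
  length g                              ∎
  where
  open ≤-Reasoning
  M : ℕ
  M = suc (maxℕ g)

dyadic-bins≥≤length : ∀ r g → ∑[ i < r ] (2 ^ i * bins≥ (2 ^ suc i) g) ≤ length g
dyadic-bins≥≤length r g = begin
  ∑[ i < r ] (2 ^ i * bins≥ (2 ^ suc i) g)
    ≡⟨ ∑-cong r (λ i → ∑-distribˡ-* M (2 ^ i) (λ j → 𝟙 (2 ^ suc i ≤? count j g))) ⟨
  ∑[ i < r ] ∑[ j < M ] (2 ^ i * 𝟙 (2 ^ suc i ≤? count j g))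
    ≡⟨ ∑-comm r M (λ i j → 2 ^ i * 𝟙 (2 ^ suc i ≤? count j g)) ⟩
  ∑[ j < M ] ∑[ i < r ] (2 ^ i * 𝟙 (2 ^ suc i ≤? count j g))
    ≤⟨ ∑-mono-≤ M (λ j _ → proj₂ (dyadic-layers (count j g) r)) ⟩
  ∑[ j < M ] count j g
    ≤⟨ ∑-count≤length M g ⟩
  length g
    ∎
  where
  open ≤-Reasoning
  M : ℕ
  M = suc (maxℕ g)

-- Loads and optimal coverings

load-∷ : ∀ x k σ f j → load (x ∷ σ) (k ∷ f) j ≡ 𝟙 (k ≟ j) · x ℚ.+ load σ f j
load-∷ x k σ f j with k ≟ j
... | yes k≡j = begin
  x ℚ.+ load σ f j               ≡⟨ cong (ℚ._+ load σ f j) (·-homo-1 x) ⟨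
  1 · x ℚ.+ load σ f j           ≡⟨ cong (λ c → c · x ℚ.+ load σ f j) (𝟙-yes (k ≟ j) k≡j) ⟨
  𝟙 (k ≟ j) · x ℚ.+ load σ f j   ∎
  where open ≡-Reasoning
... | no  k≢j = begin
  load σ f j                     ≡⟨ ℚP.+-identityˡ (load σ f j) ⟨
  0 · x ℚ.+ load σ f j           ≡⟨ cong (λ c → c · x ℚ.+ load σ f j) (𝟙-no (k ≟ j) k≢j) ⟨
  𝟙 (k ≟ j) · x ℚ.+ load σ f j   ∎
  where open ≡-Reasoning

load-replicate-++ : ∀ x g τ f j →
                    load (replicate (length g) x ++ τ) (g ++ f) j ≡ count j g · x ℚ.+ load τ f j
load-replicate-++ x []      τ f j = sym (ℚP.+-identityˡ (load τ f j))
load-replicate-++ x (k ∷ g) τ f j = begin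
  load (x ∷ replicate (length g) x ++ τ) (k ∷ g ++ f) j
    ≡⟨ load-∷ x k (replicate (length g) x ++ τ) (g ++ f) j ⟩
  𝟙 (k ≟ j) · x ℚ.+ load (replicate (length g) x ++ τ) (g ++ f) j
    ≡⟨ cong (𝟙 (k ≟ j) · x ℚ.+_) (load-replicate-++ x g τ f j) ⟩
  𝟙 (k ≟ j) · x ℚ.+ (count j g · x ℚ.+ load τ f j)
    ≡⟨ ℚP.+-assoc (𝟙 (k ≟ j) · x) (count j g · x) (load τ f j) ⟨
  𝟙 (k ≟ j) · x ℚ.+ count j g · x ℚ.+ load τ f j
    ≡⟨ cong (ℚ._+ load τ f j) (·-homo-+ x (𝟙 (k ≟ j)) (count j g)) ⟨
  count j (k ∷ g) · x ℚ.+ load τ f j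
    ∎
  where open ≡-Reasoning

load-replicate : ∀ x g j → load (replicate (length g) x) g j ≡ count j g · x
load-replicate x g j = begin
  load (replicate (length g) x) g j
    ≡⟨ cong₂ (λ σ f → load σ f j) (++-identityʳ (replicate (length g) x)) (++-identityʳ g) ⟨
  load (replicate (length g) x ++ []) (g ++ []) j
    ≡⟨ load-replicate-++ x g [] [] j ⟩
  count j g · x ℚ.+ 0ℚ
    ≡⟨ ℚP.+-identityʳ _ ⟩
  count j g · x
    ∎
  where open ≡-Reasoning

length-filter-applyUpTo : ∀ {P : ℕ → Set} (P? : Decidable P) g M →
                          length (filter P? (applyUpTo g M)) ≡ ∑[ j < M ] 𝟙 (P? (g j))
length-filter-applyUpTo P? g zero = refl
length-filter-applyUpTo P? g (suc M) with does (P? (g 0))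
... | true  = cong suc (length-filter-applyUpTo P? (g ∘ suc) M)
... | false = length-filter-applyUpTo P? (g ∘ suc) M

covered≡∑ : ∀ σ F → covered σ F ≡ ∑[ j < suc (maxℕ F) ] 𝟙 (1ℚ ℚP.≤? load σ F j)
covered≡∑ σ F = length-filter-applyUpTo (λ j → 1ℚ ℚP.≤? load σ F j) (λ j → j) (suc (maxℕ F))

maxℕ-∈ : ∀ {x xs} → x ∈ xs → x ≤ maxℕ xs
maxℕ-∈ {xs = y ∷ ys} (here refl)  = m≤m⊔n y (maxℕ ys)
maxℕ-∈ {xs = y ∷ ys} (there x∈ys) = ≤-trans (maxℕ-∈ x∈ys) (m≤n⊔m y (maxℕ ys))

B≤suc-maxℕ-++-downFrom : ∀ xs B → B ≤ suc (maxℕ (xs ++ downFrom B))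
B≤suc-maxℕ-++-downFrom xs zero    = z≤n
B≤suc-maxℕ-++-downFrom xs (suc B) = s≤s (maxℕ-∈ (∈-++⁺ʳ xs (here refl)))

∈-assignments : ∀ f m → All (_< m) f → f ∈ assignments (length f) m
∈-assignments []      m []          = here refl
∈-assignments (x ∷ f) m (x<m ∷ f<m) =
  ∈-concat⁺′ (∈-map⁺ (x ∷_) (∈-assignments f m f<m))
             (∈-map⁺ (λ j → map (j ∷_) (assignments (length f) m)) (∈-upTo⁺ x<m))

covered≤OPT : ∀ σ f → length f ≡ length σ → All (_< length σ) f → covered σ f ≤ OPT σ
covered≤OPT σ f |f|≡|σ| f<|σ| = maxℕ-∈ (∈-map⁺ (covered σ)
  (subst (λ n → f ∈ assignments n (length σ)) |f|≡|σ| (∈-assignments f (length σ) f<|σ|)))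

-- Online algorithms with advice

prefixes-++ : ∀ (xs ys : List ℚ) → prefixes (xs ++ ys) ≡ prefixes xs ++ map (xs ++_) (prefixes ys)
prefixes-++ []       ys = sym (map-id (prefixes ys))
prefixes-++ (x ∷ xs) ys = cong ([ x ] ∷_) (begin
  map (x ∷_) (prefixes (xs ++ ys))
    ≡⟨ cong (map (x ∷_)) (prefixes-++ xs ys) ⟩
  map (x ∷_) (prefixes xs ++ map (xs ++_) (prefixes ys))
    ≡⟨ map-++ (x ∷_) (prefixes xs) _ ⟩
  map (x ∷_) (prefixes xs) ++ map (x ∷_) (map (xs ++_) (prefixes ys))
    ≡⟨ cong (map (x ∷_) (prefixes xs) ++_) (map-∘ (prefixes ys)) ⟨
  map (x ∷_) (prefixes xs) ++ map ((x ∷ xs) ++_) (prefixes ys)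
    ∎)
  where open ≡-Reasoning

length-prefixes : ∀ xs → length (prefixes xs) ≡ length xs
length-prefixes []       = refl
length-prefixes (x ∷ xs) = cong suc (trans (length-map (x ∷_) (prefixes xs)) (length-prefixes xs))

length-run : ∀ A Φ σ → length (run A Φ σ) ≡ length σ
length-run A Φ σ = trans (length-map (A Φ) (prefixes σ)) (length-prefixes σ)

run-++ : ∀ A Φ xs ys → ∃ λ h → run A Φ (xs ++ ys) ≡ run A Φ xs ++ h × length h ≡ length ys
run-++ A Φ xs ys =
    map (A Φ) (map (xs ++_) (prefixes ys))
  , trans (cong (map (A Φ)) (prefixes-++ xs ys)) (map-++ (A Φ) (prefixes xs) _)
  , trans (length-map (A Φ) (map (xs ++_) (prefixes ys)))
          (trans (length-map (xs ++_) (prefixes ys)) (length-prefixes ys))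

bitStrings : ℕ → List (List Bool)
bitStrings zero    = [] ∷ []
bitStrings (suc s) = map (true ∷_) (bitStrings s) ++ map (false ∷_) (bitStrings s)

length-bitStrings : ∀ s → length (bitStrings s) ≡ 2 ^ s
length-bitStrings zero    = refl
length-bitStrings (suc s) = begin
  length (map (true ∷_) (bitStrings s) ++ map (false ∷_) (bitStrings s))
    ≡⟨ length-++ (map (true ∷_) (bitStrings s)) ⟩
  length (map (true ∷_) (bitStrings s)) + length (map (false ∷_) (bitStrings s))
    ≡⟨ cong₂ _+_ (length-map (true ∷_) (bitStrings s)) (length-map (false ∷_) (bitStrings s)) ⟩
  length (bitStrings s) + length (bitStrings s)
    ≡⟨ cong (λ n → n + n) (length-bitStrings s) ⟩
  2 ^ s + 2 ^ s
    ≡⟨ cong (2 ^ s +_) (+-identityʳ (2 ^ s)) ⟨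
  2 ^ suc s
    ∎
  where open ≡-Reasoning

applyUpTo∈bitStrings : ∀ (Φ : Advice) s → applyUpTo Φ s ∈ bitStrings s
applyUpTo∈bitStrings Φ zero = here refl
applyUpTo∈bitStrings Φ (suc s) with Φ 0
... | true  = ∈-++⁺ˡ (∈-map⁺ (true ∷_) (applyUpTo∈bitStrings (Φ ∘ suc) s))
... | false = ∈-++⁺ʳ (map (true ∷_) (bitStrings s)) (∈-map⁺ (false ∷_) (applyUpTo∈bitStrings (Φ ∘ suc) s))

fromBits : List Bool → Advice
fromBits []       _       = false
fromBits (b ∷ bs) zero    = b
fromBits (b ∷ bs) (suc i) = fromBits bs i

agree-fromBits-applyUpTo : ∀ Φ s → AgreeUpTo s Φ (fromBits (applyUpTo Φ s))
agree-fromBits-applyUpTo Φ (suc s) zero    _         = refl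
agree-fromBits-applyUpTo Φ (suc s) (suc i) (s≤s i<s) = agree-fromBits-applyUpTo (Φ ∘ suc) s i i<s

-- The adversarial input

module ItemSizes (r t : ℕ) (1≤t : 1 ≤ t) (t≤2^r : t ≤ 2 ^ r) where

  ε : ℚ
  ε = ½^ suc r

  β : ℚ
  β = 1ℚ ℚ.- t · ε

  ε-pos : 0ℚ ℚ.< ε
  ε-pos = ½^-pos (suc r)

  t·ε≤½ : t · ε ℚ.≤ ½
  t·ε≤½ = ℚP.≤-trans (·-monoˡ-≤ ε (ℚP.<⇒≤ ε-pos) t≤2^r) (ℚP.≤-reflexive (2^k·½^[1+k]≡½ r))

  t·ε<1 : t · ε ℚ.< 1ℚ
  t·ε<1 = ℚP.≤-<-trans t·ε≤½ ½<1

  ε-valid : ValidItem ε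
  ε-valid = ε-pos , ℚP.<⇒≤ (begin-strict
    ε       ≡⟨ ·-homo-1 ε ⟨
    1 · ε   ≤⟨ ·-monoˡ-≤ ε (ℚP.<⇒≤ ε-pos) 1≤t ⟩
    t · ε   <⟨ t·ε<1 ⟩
    1ℚ      ∎)
    where open ℚP.≤-Reasoning

  β-valid : ValidItem β
  β-valid = subst (ℚ._< β) (ℚP.+-inverseʳ (t · ε)) (ℚP.+-monoˡ-< (ℚ.- (t · ε)) t·ε<1)
          , ℚP.≤-trans (ℚP.+-monoʳ-≤ 1ℚ (ℚP.neg-antimono-≤ (·-nonNeg t (ℚP.<⇒≤ ε-pos))))
                       (ℚP.≤-reflexive (ℚP.+-identityʳ 1ℚ))

  t·ε+β≡1 : t · ε ℚ.+ β ≡ 1ℚ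
  t·ε+β≡1 = solve 1 (λ T → T :+ (con 1ℚ :- T) := con 1ℚ) refl (t · ε)
    where open ℚ-Solver

  t·ε+1·β-covers : 1ℚ ℚ.≤ t · ε ℚ.+ 1 · β
  t·ε+1·β-covers = ℚP.≤-reflexive (sym (trans (cong (t · ε ℚ.+_) (·-homo-1 β)) t·ε+β≡1))

  below-t·ε+1·β-uncovered : ∀ {cs cb} → cs < t → cb ≤ 1 → cs · ε ℚ.+ cb · β ℚ.< 1ℚ
  below-t·ε+1·β-uncovered {cs} {cb} cs<t cb≤1 = begin-strict
    cs · ε ℚ.+ cb · β   ≤⟨ ℚP.+-monoʳ-≤ (cs · ε) (·-monoˡ-≤ β (ℚP.<⇒≤ (proj₁ β-valid)) cb≤1) ⟩
    cs · ε ℚ.+ 1 · β    ≡⟨ cong (cs · ε ℚ.+_) (·-homo-1 β) ⟩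
    cs · ε ℚ.+ β        <⟨ ℚP.+-monoˡ-< β (subst (ℚ._< ε ℚ.+ cs · ε) (ℚP.+-identityˡ (cs · ε))
                                                  (ℚP.+-monoˡ-< (cs · ε) ε-pos)) ⟩
    suc cs · ε ℚ.+ β    ≤⟨ ℚP.+-monoˡ-≤ β (·-monoˡ-≤ ε (ℚP.<⇒≤ ε-pos) cs<t) ⟩
    t · ε ℚ.+ β         ≡⟨ t·ε+β≡1 ⟩
    1ℚ                  ∎
    where open ℚP.≤-Reasoning

module Instance (r t N V : ℕ) (1≤t : 1 ≤ t) (t≤2^r : t ≤ 2 ^ r) (t*[V+V]≡N : t * (V + V) ≡ N) where

  open ItemSizes r t 1≤t t≤2^r public

  σ : List ℚ
  σ = replicate N ε ++ replicate (V + V) β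

  σ-valid : All ValidItem σ
  σ-valid = ++⁺ (replicate⁺ N ε-valid) (replicate⁺ (V + V) β-valid)

  length-σ : length σ ≡ N + (V + V)
  length-σ = trans (length-++ (replicate N ε)) (cong₂ _+_ (length-replicate N) (length-replicate (V + V)))

  load-σ : ∀ g h j → length g ≡ N → length h ≡ V + V → load σ (g ++ h) j ≡ count j g · ε ℚ.+ count j h · β
  load-σ g h j |g|≡N |h|≡2V rewrite sym |g|≡N | sym |h|≡2V =
    trans (load-replicate-++ ε g (replicate (length h) β) h j) (cong (count j g · ε ℚ.+_) (load-replicate β h j))

  𝟙-covered≤ : ∀ cs cb → 𝟙 (1ℚ ℚP.≤? cs · ε ℚ.+ cb · β) ≤ 𝟙 (t ≤? cs) + 𝟙 (2 ≤? cb)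
  𝟙-covered≤ cs cb = bound (1ℚ ℚP.≤? cs · ε ℚ.+ cb · β) (t ≤? cs) (2 ≤? cb)
    where
    bound : (c : Dec (1ℚ ℚ.≤ cs · ε ℚ.+ cb · β)) (d : Dec (t ≤ cs)) (e : Dec (2 ≤ cb)) → 𝟙 c ≤ 𝟙 d + 𝟙 e
    bound (no _)       _         _         = z≤n
    bound (yes _)      (yes _)   _         = s≤s z≤n
    bound (yes _)      (no _)    (yes _)   = s≤s z≤n
    bound (yes covers) (no t≰cs) (no 2≰cb) =
      ⊥-elim (<⇒≱ℚ (below-t·ε+1·β-uncovered (≰⇒> t≰cs) (≤-pred (≰⇒> 2≰cb))) covers)

  covered-≤ : ∀ g h → length g ≡ N → length h ≡ V + V → covered σ (g ++ h) ≤ bins≥ t g + V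
  covered-≤ g h |g|≡N |h|≡2V = begin
    covered σ (g ++ h)
      ≡⟨ covered≡∑ σ (g ++ h) ⟩
    ∑[ j < M ] 𝟙 (1ℚ ℚP.≤? load σ (g ++ h) j)
      ≡⟨ ∑-cong M (λ j → cong (λ q → 𝟙 (1ℚ ℚP.≤? q)) (load-σ g h j |g|≡N |h|≡2V)) ⟩
    ∑[ j < M ] 𝟙 (1ℚ ℚP.≤? count j g · ε ℚ.+ count j h · β)
      ≤⟨ ∑-mono-≤ M (λ j _ → 𝟙-covered≤ (count j g) (count j h)) ⟩
    ∑[ j < M ] (𝟙 (t ≤? count j g) + 𝟙 (2 ≤? count j h))
      ≡⟨ ∑-distrib-+ M (λ j → 𝟙 (t ≤? count j g)) (λ j → 𝟙 (2 ≤? count j h)) ⟩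
    ∑[ j < M ] 𝟙 (t ≤? count j g) + ∑[ j < M ] 𝟙 (2 ≤? count j h)
      ≤⟨ +-mono-≤ (∑-𝟙≤bins≥ g M 1≤t) (∑-𝟙≤bins≥ h M (s≤s z≤n)) ⟩
    bins≥ t g + bins≥ 2 h
      ≤⟨ +-monoʳ-≤ (bins≥ t g) bins≥2≤V ⟩
    bins≥ t g + V
      ∎
    where
    open ≤-Reasoning
    M : ℕ
    M = suc (maxℕ (g ++ h))
    bins≥2≤V : bins≥ 2 h ≤ V
    bins≥2≤V = *-cancelˡ-≤ 2 (≤-trans (*-bins≥≤length 2 h)
                                      (≤-reflexive (trans |h|≡2V (cong (V +_) (sym (+-identityʳ V))))))

  optimal : List ℕ
  optimal = concat (replicate t (downFrom (V + V))) ++ downFrom (V + V)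

  optimal-covers : ∀ j → j < V + V → 1ℚ ℚ.≤ load σ optimal j
  optimal-covers j j<2V = subst (1ℚ ℚ.≤_) (sym load≡t·ε+1·β) t·ε+1·β-covers
    where
    count-downFrom≡1 : count j (downFrom (V + V)) ≡ 1
    count-downFrom≡1 = count-downFrom-< (V + V) j<2V
    load≡t·ε+1·β : load σ optimal j ≡ t · ε ℚ.+ 1 · β
    load≡t·ε+1·β = begin
      load σ optimal j
        ≡⟨ load-σ (concat (replicate t (downFrom (V + V)))) (downFrom (V + V)) j
             (trans (length-concat-replicate t _) (trans (cong (t *_) (length-downFrom (V + V))) t*[V+V]≡N))
             (length-downFrom (V + V)) ⟩
      count j (concat (replicate t (downFrom (V + V)))) · ε ℚ.+ count j (downFrom (V + V)) · β
        ≡⟨ cong₂ (λ a b → a · ε ℚ.+ b · β)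
             (trans (count-concat-replicate j t _) (trans (cong (t *_) count-downFrom≡1) (*-identityʳ t)))
             count-downFrom≡1 ⟩
      t · ε ℚ.+ 1 · β
        ∎
      where open ≡-Reasoning

  2V≤OPT : V + V ≤ OPT σ
  2V≤OPT = begin
    V + V
      ≡⟨ trans (∑-const (V + V) 1) (*-identityʳ (V + V)) ⟨
    ∑[ j < V + V ] 1
      ≤⟨ ∑-mono-≤ (V + V) (λ j j<2V → ≤-reflexive (sym (𝟙-yes (1ℚ ℚP.≤? load σ optimal j) (optimal-covers j j<2V)))) ⟩
    ∑[ j < V + V ] 𝟙 (1ℚ ℚP.≤? load σ optimal j)
      ≤⟨ ∑-mono-range (λ j → 𝟙 (1ℚ ℚP.≤? load σ optimal j))
                      (B≤suc-maxℕ-++-downFrom (concat (replicate t (downFrom (V + V)))) (V + V)) ⟩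
    ∑[ j < suc (maxℕ optimal) ] 𝟙 (1ℚ ℚP.≤? load σ optimal j)
      ≡⟨ covered≡∑ σ optimal ⟨
    covered σ optimal
      ≤⟨ covered≤OPT σ optimal |optimal|≡|σ| optimal<|σ| ⟩
    OPT σ
      ∎
    where
    open ≤-Reasoning
    |optimal|≡|σ| : length optimal ≡ length σ
    |optimal|≡|σ| = begin-equality
      length optimal
        ≡⟨ length-++ (concat (replicate t (downFrom (V + V)))) ⟩
      length (concat (replicate t (downFrom (V + V)))) + length (downFrom (V + V))
        ≡⟨ cong₂ _+_ (length-concat-replicate t _) (length-downFrom (V + V)) ⟩
      t * length (downFrom (V + V)) + (V + V)
        ≡⟨ cong (λ n → t * n + (V + V)) (length-downFrom (V + V)) ⟩
      t * (V + V) + (V + V)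
        ≡⟨ cong (_+ (V + V)) t*[V+V]≡N ⟩
      N + (V + V)
        ≡⟨ length-σ ⟨
      length σ
        ∎
    downFrom<|σ| : All (_< length σ) (downFrom (V + V))
    downFrom<|σ| = applyDownFrom⁺₁ (λ j → j) (V + V)
      (λ j<2V → <-≤-trans j<2V (subst (V + V ≤_) (sym length-σ) (m≤n+m (V + V) N)))
    optimal<|σ| : All (_< length σ) optimal
    optimal<|σ| = ++⁺ (concat⁺ (replicate⁺ t downFrom<|σ|)) downFrom<|σ|

½+μ-gap : ∀ {μ b P Q opt alg D V} → 0ℚ ℚ.< μ → 1ℚ ℚ.≤ P · μ → b ℚ.≤ toℚ Q →
          V + V ≤ opt → alg ≤ D + V → P * (D + Q + 1) ≤ V + V →
          toℚ alg ℚ.< (½ ℚ.+ μ) ℚ.* toℚ opt ℚ.- b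
½+μ-gap {μ} {b} {P} {Q} {opt} {alg} {D} {V} 0<μ 1≤P·μ b≤Q 2V≤opt alg≤D+V P*[D+Q+1]≤2V = begin-strict
  toℚ alg
    ≤⟨ toℚ-mono-≤ alg≤D+V ⟩
  toℚ (D + V)
    ≡⟨ toℚ-+ D V ⟩
  toℚ D ℚ.+ toℚ V
    <⟨ subst (ℚ._< toℚ D ℚ.+ toℚ V ℚ.+ 1ℚ) (ℚP.+-identityʳ _) (ℚP.+-monoʳ-< (toℚ D ℚ.+ toℚ V) (ℚP.positive⁻¹ 1ℚ)) ⟩
  toℚ D ℚ.+ toℚ V ℚ.+ 1ℚ
    ≡⟨ rearrange ⟩
  toℚ V ℚ.+ toℚ (D + Q + 1) ℚ.- toℚ Q
    ≤⟨ ℚP.+-mono-≤ (ℚP.+-mono-≤ (ℚP.≤-reflexive (sym half-2V))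
                                 (toℚ-≤-μ* {P = P} {M = D + Q + 1} (ℚP.<⇒≤ 0<μ) 1≤P·μ P*[D+Q+1]≤2V))
                   (ℚP.neg-antimono-≤ b≤Q) ⟩
  ½ ℚ.* toℚ (V + V) ℚ.+ μ ℚ.* toℚ (V + V) ℚ.- b
    ≡⟨ cong (ℚ._- b) (ℚP.*-distribʳ-+ (toℚ (V + V)) ½ μ) ⟨
  (½ ℚ.+ μ) ℚ.* toℚ (V + V) ℚ.- b
    ≤⟨ ℚP.+-monoˡ-≤ (ℚ.- b) (ℚP.*-monoˡ-≤-nonNeg (½ ℚ.+ μ) {{½+μ≥0}} (toℚ-mono-≤ 2V≤opt)) ⟩
  (½ ℚ.+ μ) ℚ.* toℚ opt ℚ.- b
    ∎
  where
  open ℚP.≤-Reasoning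
  open ℚ-Solver
  ½+μ≥0 : ℚ.NonNegative (½ ℚ.+ μ)
  ½+μ≥0 = ℚ.nonNegative (ℚP.≤-trans (ℚP.nonNegative⁻¹ ½)
    (subst (ℚ._≤ ½ ℚ.+ μ) (ℚP.+-identityʳ ½) (ℚP.+-monoʳ-≤ ½ (ℚP.<⇒≤ 0<μ))))
  half-2V : ½ ℚ.* toℚ (V + V) ≡ toℚ V
  half-2V = trans (cong (½ ℚ.*_) (toℚ-+ V V)) (solve 1 (λ v → con ½ :* (v :+ v) := v) refl (toℚ V))
  rearrange : toℚ D ℚ.+ toℚ V ℚ.+ 1ℚ ≡ toℚ V ℚ.+ toℚ (D + Q + 1) ℚ.- toℚ Q
  rearrange rewrite toℚ-+ (D + Q) 1 | toℚ-+ D Q =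
    solve 3 (λ d v q → d :+ v :+ con 1ℚ := v :+ (d :+ q :+ con 1ℚ) :- q) refl (toℚ D) (toℚ V) (toℚ Q)

2^[C*2^s]≤n : ∀ C s {n} → 2 ^ C ≤ n → 2 ^ (2 ^ (suc C * s)) ≤ n → 2 ^ (C * 2 ^ s) ≤ n
2^[C*2^s]≤n C zero      {n} 2^C≤n _   = subst (λ e → 2 ^ e ≤ n) (sym (*-identityʳ C)) 2^C≤n
2^[C*2^s]≤n C s@(suc _)     _     big = ≤-trans (^-monoʳ-≤ 2 C*2^s≤2^[[1+C]*s]) big
  where
  C*2^s≤2^[[1+C]*s] : C * 2 ^ s ≤ 2 ^ (suc C * s)
  C*2^s≤2^[[1+C]*s] = begin
    C * 2 ^ s             ≡⟨ *-comm C (2 ^ s) ⟩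
    2 ^ s * C             ≤⟨ *-monoʳ-≤ (2 ^ s) (<⇒≤ (n<2^n C)) ⟩
    2 ^ s * 2 ^ C         ≤⟨ *-monoʳ-≤ (2 ^ s) (^-monoʳ-≤ 2 (m≤m*n C s)) ⟩
    2 ^ s * 2 ^ (C * s)   ≡⟨ ^-distribˡ-+-* 2 s (C * s) ⟨
    2 ^ (suc C * s)       ∎
    where open ≤-Reasoning

module Adversary (A : Algorithm) (P Q s : ℕ) (1≤P : 1 ≤ P) where

  open ℕ-Solver

  K m r N : ℕ
  K = P * (Q + 1)
  m = 2 ^ s
  r = 4 * P * m
  N = 2 ^ suc r * K

  tiny : List ℚ
  tiny = replicate N (½^ suc r)

  placement : List Bool → List ℕ
  placement w = run A (fromBits w) tiny

  length-placement : ∀ w → length (placement w) ≡ N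
  length-placement w = trans (length-run A (fromBits w) tiny) (length-replicate N)

  Y : ℕ → ℕ
  Y i = sum (map (λ w → 2 ^ i * bins≥ (2 ^ suc i) (placement w)) (bitStrings s))

  ∑Y≤m*N : ∑[ i < r ] Y i ≤ m * N
  ∑Y≤m*N = begin
    ∑[ i < r ] Y i
      ≡⟨ ∑-sum-map-comm r (bitStrings s) (λ w i → 2 ^ i * bins≥ (2 ^ suc i) (placement w)) ⟩
    sum (map (λ w → ∑[ i < r ] (2 ^ i * bins≥ (2 ^ suc i) (placement w))) (bitStrings s))
      ≤⟨ sum-map-≤ _ (bitStrings s) (λ w → ≤-trans (dyadic-bins≥≤length r (placement w))
                                                    (≤-reflexive (length-placement w))) ⟩
    length (bitStrings s) * N
      ≡⟨ cong (_* N) (length-bitStrings s) ⟩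
    m * N
      ∎
    where open ≤-Reasoning

  level : ∃ λ i → i < r × r * Y i ≤ ∑[ j < r ] Y j
  level = pigeonhole Y r (*-mono-≤ {1} {4 * P} (≤-trans 1≤P (m≤n*m P 4)) (m^n>0 2 s))

  i : ℕ
  i = proj₁ level

  i<r : i < r
  i<r = proj₁ (proj₂ level)

  t V : ℕ
  t = 2 ^ suc i
  V = 2 ^ (r ∸ suc i) * K

  t*[V+V]≡N : t * (V + V) ≡ N
  t*[V+V]≡N = begin
    t * (V + V)
      ≡⟨ solve 3 (λ t e k → t :* (e :* k :+ e :* k) := (con 2 :* (t :* e)) :* k) refl t (2 ^ (r ∸ suc i)) K ⟩
    2 * (t * 2 ^ (r ∸ suc i)) * K
      ≡⟨ cong (λ e → 2 * e * K) (^-distribˡ-+-* 2 (suc i) (r ∸ suc i)) ⟨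
    2 ^ suc (suc i + (r ∸ suc i)) * K
      ≡⟨ cong (λ e → 2 ^ suc e * K) (m+[n∸m]≡n i<r) ⟩
    N
      ∎
    where open ≡-Reasoning

  open Instance r t N V (m^n>0 2 (suc i)) (^-monoʳ-≤ 2 i<r) t*[V+V]≡N public

  |σ|≤2^[[4P+2+K]*m] : length σ ≤ 2 ^ ((4 * P + 2 + K) * m)
  |σ|≤2^[[4P+2+K]*m] = begin
    length σ                    ≡⟨ length-σ ⟩
    N + (V + V)                 ≤⟨ +-monoʳ-≤ N (subst (V + V ≤_) t*[V+V]≡N (m≤n*m (V + V) t {{m^n≢0 2 (suc i)}})) ⟩
    N + N                       ≡⟨ solve 2 (λ x k → x :* k :+ x :* k := (con 2 :* x) :* k) refl (2 ^ suc r) K ⟩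
    2 ^ suc (suc r) * K         ≤⟨ *-monoʳ-≤ (2 ^ suc (suc r)) (<⇒≤ (n<2^n K)) ⟩
    2 ^ suc (suc r) * 2 ^ K     ≡⟨ ^-distribˡ-+-* 2 (suc (suc r)) K ⟨
    2 ^ (suc (suc r) + K)       ≤⟨ ^-monoʳ-≤ 2 exponent≤ ⟩
    2 ^ ((4 * P + 2 + K) * m)   ∎
    where
    open ≤-Reasoning
    exponent≤ : suc (suc r) + K ≤ (4 * P + 2 + K) * m
    exponent≤ = subst₂ _≤_
      (solve 2 (λ r k → r :+ (con 2 :+ k) := con 2 :+ r :+ k) refl r K)
      (solve 3 (λ p m k → con 4 :* p :* m :+ (con 2 :* m :+ k :* m) := (con 4 :* p :+ con 2 :+ k) :* m) refl P m K)
      (+-monoʳ-≤ r (+-mono-≤ (m≤m*n 2 m {{m^n≢0 2 s}}) (m≤m*n K m {{m^n≢0 2 s}})))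

  Acov≤bins≥+V : ∀ Φ → (∀ Ψ → AgreeUpTo s Φ Ψ → run A Ψ σ ≡ run A Φ σ) →
                 Acov A Φ σ ≤ bins≥ t (placement (applyUpTo Φ s)) + V
  Acov≤bins≥+V Φ reads-s with run-++ A (fromBits (applyUpTo Φ s)) tiny (replicate (V + V) β)
  ... | h , run≡ , |h|≡ = subst (λ F → covered σ F ≤ bins≥ t (placement (applyUpTo Φ s)) + V)
        (trans (sym run≡) (reads-s (fromBits (applyUpTo Φ s)) (agree-fromBits-applyUpTo Φ s)))
        (covered-≤ (placement (applyUpTo Φ s)) h (length-placement (applyUpTo Φ s))
                   (trans |h|≡ (length-replicate (V + V))))

  P*[D+Q+1]≤2V : ∀ {w} → w ∈ bitStrings s → P * (bins≥ t (placement w) + Q + 1) ≤ V + V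
  P*[D+Q+1]≤2V {w} w∈ = subst (_≤ V + V)
    (solve 3 (λ p d q → p :* d :+ p :* (q :+ con 1) := p :* (d :+ q :+ con 1)) refl P D Q)
    (+-mono-≤ P*D≤V (m≤n*m K (2 ^ (r ∸ suc i)) {{m^n≢0 2 (r ∸ suc i)}}))
    where
    D : ℕ
    D = bins≥ t (placement w)
    r*[2^i*D]≤m*N : r * (2 ^ i * D) ≤ m * N
    r*[2^i*D]≤m*N = ≤-trans (*-monoʳ-≤ r (∈⇒≤sum-map (λ w → 2 ^ i * bins≥ t (placement w)) w∈))
                            (≤-trans (proj₂ (proj₂ level)) ∑Y≤m*N)
    P*D≤V : P * D ≤ V
    P*D≤V = *-cancelˡ-≤ (m * 2 ^ suc (suc i)) {{m*n≢0 m (2 ^ suc (suc i)) {{m^n≢0 2 s}} {{m^n≢0 2 (suc (suc i))}}}}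
      (subst₂ _≤_
        (solve 4 (λ p m a d → con 4 :* p :* m :* (a :* d) := m :* (con 2 :* (con 2 :* a)) :* (p :* d)) refl P m (2 ^ i) D)
        (trans (cong (m *_) (sym t*[V+V]≡N))
               (solve 3 (λ m a v → m :* ((con 2 :* a) :* (v :+ v)) := m :* (con 2 :* (con 2 :* a)) :* v) refl m (2 ^ i) V))
        r*[2^i*D]≤m*N)

  Acov<[½+μ]*OPT-b : ∀ {μ b} → 0ℚ ℚ.< μ → 1ℚ ℚ.≤ P · μ → b ℚ.≤ toℚ Q →
                     ∀ Φ → (∀ Ψ → AgreeUpTo s Φ Ψ → run A Ψ σ ≡ run A Φ σ) →
                     toℚ (Acov A Φ σ) ℚ.< (½ ℚ.+ μ) ℚ.* toℚ (OPT σ) ℚ.- b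
  Acov<[½+μ]*OPT-b 0<μ 1≤P·μ b≤Q Φ reads-s =
    ½+μ-gap {P = P} {D = bins≥ t (placement (applyUpTo Φ s))} {V = V} 0<μ 1≤P·μ b≤Q 2V≤OPT
            (Acov≤bins≥+V Φ reads-s) (P*[D+Q+1]≤2V (applyUpTo∈bitStrings Φ s))

theorem2 : (A : Algorithm) (s : ℕ → ℕ) → LittleOLogLog s →
    (μ : ℚ) → 0ℚ ℚ.< μ → ¬ Competitive A s (½ ℚ.+ μ)
theorem2 A s s∈o[loglog] μ 0<μ (b , competitive) =
  let Φ , ratio , reads-s = competitive n σ |σ|≤n σ-valid
  in  <⇒≱ℚ (Acov<[½+μ]*OPT-b 0<μ (proj₂ (·-archimedean μ 0<μ)) (proj₂ (toℚ-unbounded b)) Φ reads-s) ratio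
  where
  P Q C n₀ n : ℕ
  P  = suc (proj₁ (·-archimedean μ 0<μ))
  Q  = proj₁ (toℚ-unbounded b)
  C  = 4 * P + 2 + P * (Q + 1)
  n₀ = proj₁ (s∈o[loglog] (suc C) (s≤s z≤n))
  n  = n₀ ⊔ 2 ^ C

  open Adversary A P Q (s n) (s≤s z≤n)

  |σ|≤n : length σ ≤ n
  |σ|≤n = ≤-trans |σ|≤2^[[4P+2+K]*m]
    (2^[C*2^s]≤n C (s n) (m≤n⊔m n₀ (2 ^ C)) (proj₂ (s∈o[loglog] (suc C) (s≤s z≤n)) n (m≤m⊔n n₀ (2 ^ C))))
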